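{- Let $T\subseteq\mathbb{Z}_2^\omega$ be a thin set such that $T\cap X\neq\emptyset$ for every equivalence class $X$ of $\sim$. Then the game $\mathcal{G}(T)$ is undetermined, i.e. neither Ego nor Alter has a winning strategy in $\mathcal{G}(T)$.
   Context: $\omega=\{0,1,2,\dots\}$; $\mathbb{Z}_2^\omega$ is the set of infinite binary sequences and $\mathbb{Z}_2^+ := \bigcup_{n\ge1}\mathbb{Z}_2^n$ the set of nonempty finite binary words. The Hamming distance is $d_H(x,y):=|\{k\in\omega: x(k)\ne y(k)\}|$ (possibly infinite); $x\sim y$ iff $d_H(x,y)$ is finite. For $n\in\omega$ let $\mathrm{pr}_n(x):=x|_{\omega\setminus\{n\}}$; a set $T\subseteq\mathbb{Z}_2^\omega$ is thin if each $\mathrm{pr}_n|_T$ is injective. For $F\subseteq\mathbb{Z}_2^\omega$, $\mathcal{G}(F)$ is the following infinite two-player game of perfect information between Ego and Alter: the players alternately choose nonempty finite words $\epsilon_0,\alpha_1,\epsilon_1,\alpha_2,\dots\in\mathbb{Z}_2^+$ (Ego chooses the $\epsilon_i$, starting with $\epsilon_0$; Alter chooses the $\alpha_i$), each knowing all previous moves; the outcome is the concatenation $\epsilon_0\alpha_1\epsilon_1\alpha_2\cdots\in\mathbb{Z}_2^\omega$. Ego wins if the outcome lies in $F$, otherwise Alter wins. Strategies are functions from finite sequences of the opponent's previous moves to $\mathbb{Z}_2^+$; a strategy is winning if every play following it is won by its owner. -}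

module Defs where

open import Data.Bool using (Bool)
open import Data.Nat using (ℕ; zero; suc; _≤_)
open import Data.List using (List; []; _∷_; map; upTo)
open import Data.List.NonEmpty using (List⁺; _∷_)
open import Data.Product using (Σ; ∃; _×_)
open import Function using (_∘_)
open import Relation.Binary.PropositionalEquality using (_≡_; _≢_; _≗_)
open import Relation.Nullary using (¬_)

Seq : Set
Seq = ℕ → Bool

Word : Set
Word = List⁺ Bool

Subset : Set₁
Subset = Seq → Set

-- x ∼ y : the Hamming distance is finite, i.e. the set of positions
-- where x and y differ is finite (bounded)
_∼_ : Seq → Seq → Set
x ∼ y = ∃ λ N → ∀ k → N ≤ k → x k ≡ y k

-- pr_n x = pr_n y  (agreement off coordinate n)
SamePr : ℕ → Seq → Seq → Set
SamePr n x y = ∀ k → k ≢ n → x k ≡ y k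

Thin : Subset → Set
Thin T = ∀ n x y → T x → T y → SamePr n x y → x ≗ y

MeetsAllClasses : Subset → Set
MeetsAllClasses T = ∀ x → ∃ λ t → T t × t ∼ x

-- T is a genuine subset of Z₂^ω (membership respects pointwise equality)
Extensional : Subset → Set
Extensional T = ∀ x y → x ≗ y → T x → T y

catFrom : Word → (ℕ → Word) → ℕ → Bool
catFrom (b ∷ bs) w zero = b
catFrom (b ∷ []) w (suc k) = catFrom (w 0) (w ∘ suc) k
catFrom (b ∷ (c ∷ cs)) w (suc k) = catFrom (c ∷ cs) w k

concatω : (ℕ → Word) → Seq
concatω w = catFrom (w 0) (w ∘ suc)

interleave : {A : Set} → (ℕ → A) → (ℕ → A) → ℕ → A
interleave e a zero = e 0
interleave e a (suc n) = interleave a (e ∘ suc) n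

prefix : {A : Set} → (ℕ → A) → ℕ → List A
prefix f n = map f (upTo n)

-- Strategies: functions from finite sequences of the opponent's previous moves
EgoStrategy : Set
EgoStrategy = List Word → Word

AlterStrategy : Set
AlterStrategy = List Word → Word

-- outcome of the play where Ego follows σ and Alter plays α₁ α₂ … (α i = α_{i+1});
-- Ego's move ε_i = σ (α₁ … α_i)
egoOutcome : EgoStrategy → (ℕ → Word) → Seq
egoOutcome σ α = concatω (interleave (λ i → σ (prefix α i)) α)

-- outcome of the play where Ego plays ε₀ ε₁ … and Alter follows τ;
-- Alter's move α_{i+1} = τ (ε₀ … ε_i)
alterOutcome : AlterStrategy → (ℕ → Word) → Seq
alterOutcome τ ε = concatω (interleave ε (λ i → τ (prefix ε (suc i))))

EgoWins : Subset → EgoStrategy → Set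
EgoWins F σ = ∀ α → F (egoOutcome σ α)

AlterWins : Subset → AlterStrategy → Set
AlterWins F τ = ∀ ε → ¬ F (alterOutcome τ ε)

Undetermined : Subset → Set
Undetermined F = (¬ ∃ λ σ → EgoWins F σ) × (¬ ∃ λ τ → AlterWins F τ)

-- Ego loses: against any strategy, Alter runs two plays that feed each other
-- Ego's moves, shifted by one bit, so that the two outcomes differ in exactly
-- one coordinate; a thin set cannot contain both.
-- Alter loses: against any strategy, Ego interleaves countably many plays, one
-- for each finitely supported mask, into a single sequence x, arranged so that
-- the play for a mask produces x xor mask. These outcomes fill the ∼-class of x,
-- which T meets.
module Submission where

open import Defs
open import Data.Bool using (Bool; true; false; _xor_)
open import Data.Bool.Properties using (xor-assoc; xor-same; xor-identityʳ)
open import Data.Nat using (ℕ; zero; suc; _+_; _∸_; _≤_; _<_; z≤n; s≤s; z<s; _<?_)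
open import Data.Nat.Properties
open import Data.Nat.Binary using (ℕᵇ; 2[1+_]; 1+[2_]; toℕ; fromℕ) renaming (zero to 0ᵇ)
open import Data.Nat.Binary.Properties using (fromℕ-toℕ)
open import Data.Nat.Induction using (<-wellFounded)
open import Data.List using (List; []; _∷_; _++_; _∷ʳ_; length; drop; applyUpTo)
open import Data.List.Properties using (++-assoc; ++-identityʳ; length-++; map-applyUpTo; applyUpTo-∷ʳ)
open import Data.List.NonEmpty using (List⁺; _∷_; toList) renaming (_∷ʳ_ to _∷ʳ⁺_)
open import Data.Product using (∃; _×_; _,_; proj₁; proj₂; uncurry)
open import Data.Sum using (inj₁; inj₂)
open import Data.Unit using (⊤; tt)
open import Function using (_∘_; id)
open import Induction.WellFounded using (module All; module FixPoint)
open import Relation.Binary.PropositionalEquality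
open import Relation.Nullary using (¬_; yes; no; contradiction)

private
  variable
    A : Set

infixr 5 _◂_

_◂_ : A → (ℕ → A) → ℕ → A
(x ◂ s) zero    = x
(x ◂ s) (suc k) = s k

AgreeBelow : ℕ → (ℕ → A) → (ℕ → A) → Set
AgreeBelow n f f′ = ∀ {m} → m < n → f m ≡ f′ m

module _ (f : ℕ → ℕ) (f-< : ∀ n → f n < f (suc n)) where

  increasing⇒monotone : ∀ {m} n → m ≤ n → f m ≤ f n
  increasing⇒monotone zero    z≤n = ≤-refl
  increasing⇒monotone (suc n) m≤1+n with m≤n⇒m<n∨m≡n m≤1+n
  ... | inj₁ m<1+n = ≤-trans (increasing⇒monotone n (≤-pred m<1+n)) (<⇒≤ (f-< n))
  ... | inj₂ refl  = ≤-refl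

  increasing⇒≥id : ∀ n → n ≤ f n
  increasing⇒≥id zero    = z≤n
  increasing⇒≥id (suc n) = ≤-trans (s≤s (increasing⇒≥id n)) (f-< n)

prefix-snoc : ∀ (f : ℕ → A) n → prefix f (suc n) ≡ prefix f n ∷ʳ f n
prefix-snoc f n = begin
  prefix f (suc n)              ≡⟨ map-applyUpTo id f (suc n) ⟩
  applyUpTo f (suc n)           ≡⟨ applyUpTo-∷ʳ f n ⟨
  applyUpTo f n ∷ʳ f n          ≡⟨ cong (_∷ʳ f n) (map-applyUpTo id f n) ⟨
  prefix f n ∷ʳ f n             ∎
  where open ≡-Reasoning

prefix-unique : (h : ℕ → List A) (f : ℕ → A) →
                h 0 ≡ [] → (∀ n → h (suc n) ≡ h n ∷ʳ f n) → ∀ n → h n ≡ prefix f n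
prefix-unique h f h0 hs zero    = h0
prefix-unique h f h0 hs (suc n) =
  trans (hs n) (trans (cong (_∷ʳ f n) (prefix-unique h f h0 hs n)) (sym (prefix-snoc f n)))

prefix-local : ∀ {f f′ : ℕ → A} n → AgreeBelow n f f′ → prefix f n ≡ prefix f′ n
prefix-local zero    eq = refl
prefix-local {f = f} {f′} (suc n) eq = begin
  prefix f (suc n)    ≡⟨ prefix-snoc f n ⟩
  prefix f n ∷ʳ f n   ≡⟨ cong₂ _∷ʳ_ (prefix-local n (eq ∘ m<n⇒m<1+n)) (eq (n<1+n n)) ⟩
  prefix f′ n ∷ʳ f′ n ≡⟨ prefix-snoc f′ n ⟨
  prefix f′ (suc n)   ∎
  where open ≡-Reasoning

infix 4 _⊑_

_⊑_ : List A → (ℕ → A) → Set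
[]      ⊑ x = ⊤
(b ∷ l) ⊑ x = b ≡ x 0 × l ⊑ (x ∘ suc)

⊑-agree : ∀ (l : List A) {x y} → l ⊑ x → l ⊑ y → ∀ {k} → k < length l → x k ≡ y k
⊑-agree (b ∷ l) (b≡x₀ , _) (b≡y₀ , _) {zero}  _         = trans (sym b≡x₀) b≡y₀
⊑-agree (b ∷ l) (_ , l⊑x)  (_ , l⊑y)  {suc k} (s≤s k<) = ⊑-agree l l⊑x l⊑y k<

drop-length-++ : ∀ (xs ys : List A) → drop (length xs) (xs ++ ys) ≡ ys
drop-length-++ []       ys = refl
drop-length-++ (x ∷ xs) ys = drop-length-++ xs ys

toList-∷ʳ : ∀ (xs : List A) x → toList (xs ∷ʳ⁺ x) ≡ xs ++ x ∷ []
toList-∷ʳ []       x = refl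
toList-∷ʳ (_ ∷ xs) x = refl

flat : (ℕ → Word) → ℕ → List Bool
flat w zero    = []
flat w (suc n) = toList (w 0) ++ flat (w ∘ suc) n

flat-snoc : ∀ w n → flat w (suc n) ≡ flat w n ++ toList (w n)
flat-snoc w zero    = ++-identityʳ (toList (w 0))
flat-snoc w (suc n) =
  trans (cong (toList (w 0) ++_) (flat-snoc (w ∘ suc) n)) (sym (++-assoc (toList (w 0)) _ _))

flat-+ : ∀ w a d → flat w (a + d) ≡ flat w a ++ flat (λ k → w (a + k)) d
flat-+ w zero    d = refl
flat-+ w (suc a) d = trans (cong (toList (w 0) ++_) (flat-+ (w ∘ suc) a d)) (sym (++-assoc (toList (w 0)) _ _))

flat-extends : ∀ w {a n} → a ≤ n → ∃ λ r → flat w n ≡ flat w a ++ r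
flat-extends w {a} a≤n = _ , trans (cong (flat w) (sym (m+[n∸m]≡n a≤n))) (flat-+ w a _)

flat-local : ∀ {w w′} n → AgreeBelow n w w′ → flat w n ≡ flat w′ n
flat-local zero    eq = refl
flat-local (suc n) eq = cong₂ (λ u l → toList u ++ l) (eq z<s) (flat-local n (eq ∘ s≤s))

flat-interleave : ∀ e a i → flat (interleave e a) (suc i + suc i)
                            ≡ flat (interleave e a) (i + i) ++ toList (e i) ++ toList (a i)
flat-interleave e a i = begin
  flat w (suc i + suc i)                            ≡⟨ cong (flat w ∘ suc) (+-suc i i) ⟩
  flat w (suc (suc (i + i)))                        ≡⟨ flat-snoc w (suc (i + i)) ⟩
  flat w (suc (i + i)) ++ toList (w (suc (i + i)))  ≡⟨ cong (_++ toList (w (suc (i + i)))) (flat-snoc w (i + i)) ⟩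
  (flat w (i + i) ++ toList (w (i + i))) ++ toList (w (suc (i + i)))
    ≡⟨ cong₂ (λ u v → (flat w (i + i) ++ toList u) ++ toList v)
             (interleave-even e a i) (interleave-even a (e ∘ suc) i) ⟩
  (flat w (i + i) ++ toList (e i)) ++ toList (a i)  ≡⟨ ++-assoc (flat w (i + i)) _ _ ⟩
  flat w (i + i) ++ toList (e i) ++ toList (a i)    ∎
  where
  open ≡-Reasoning
  w = interleave e a
  interleave-even : ∀ (e a : ℕ → Word) n → interleave e a (n + n) ≡ e n
  interleave-even e a zero    = refl
  interleave-even e a (suc n) =
    trans (cong (interleave e a ∘ suc) (+-suc n n)) (interleave-even (e ∘ suc) (a ∘ suc) n)

interleave-cong : ∀ {e e′ a a′ : ℕ → A} → e ≗ e′ → a ≗ a′ → interleave e a ≗ interleave e′ a′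
interleave-cong e≗ a≗ zero    = e≗ 0
interleave-cong e≗ a≗ (suc k) = interleave-cong a≗ (e≗ ∘ suc) k

catFrom-offset : ∀ u w k → catFrom u w (length (toList u) + k) ≡ concatω w k
catFrom-offset (b ∷ l) w k = go b l
  where
  go : ∀ b l → catFrom (b ∷ l) w (length (b ∷ l) + k) ≡ concatω w k
  go b []       = refl
  go b (c ∷ cs) = go c cs

catFrom-below : ∀ u w w′ {k} → k < length (toList u) → catFrom u w k ≡ catFrom u w′ k
catFrom-below (b ∷ l) w w′ = go b l
  where
  go : ∀ b l {k} → k < length (b ∷ l) → catFrom (b ∷ l) w k ≡ catFrom (b ∷ l) w′ k
  go b l        {zero}  _          = refl
  go b (c ∷ cs) {suc k} (s≤s k<) = go c cs k<

catFrom-cong : ∀ u {w w′} → w ≗ w′ → catFrom u w ≗ catFrom u w′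
catFrom-cong (b ∷ l) = go b l
  where
  go : ∀ b l {w w′} → w ≗ w′ → catFrom (b ∷ l) w ≗ catFrom (b ∷ l) w′
  go b []       w≗ zero    = refl
  go b []       w≗ (suc k) = trans (cong (λ u → catFrom u _ k) (w≗ 0)) (catFrom-cong _ (w≗ ∘ suc) k)
  go b (c ∷ cs) w≗ zero    = refl
  go b (c ∷ cs) w≗ (suc k) = go c cs w≗ k

⊑-catFrom : ∀ u w n → toList u ++ flat w n ⊑ catFrom u w
⊑-catFrom (b ∷ l) = go b l
  where
  go : ∀ b l w n → b ∷ l ++ flat w n ⊑ catFrom (b ∷ l) w
  go b []       w zero    = refl , tt
  go b []       w (suc n) = refl , ⊑-catFrom (w 0) (w ∘ suc) n
  go b (c ∷ cs) w n       = refl , go c cs w n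

⊑-concatω : ∀ w n → flat w n ⊑ concatω w
⊑-concatω w zero    = tt
⊑-concatω w (suc n) = ⊑-catFrom (w 0) (w ∘ suc) n

catFrom-split : ∀ u b b′ v w → SamePr (length (toList u))
                  (catFrom u ((b ∷ []) ◂ v ◂ w)) (catFrom u ((b′ ∷ toList v) ◂ w))
catFrom-split u b b′ v w k k≢L with k <? length (toList u)
... | yes k<L = catFrom-below u _ _ k<L
... | no  k≮L with m≤n⇒∃[o]m+o≡n (≮⇒≥ k≮L)
...   | zero  , L+0≡k = contradiction (trans (sym L+0≡k) (+-identityʳ _)) k≢L
...   | suc o , refl  = trans (catFrom-offset u _ (suc o)) (sym (trans (catFrom-offset u _ (suc o)) (tail v)))
  where
  tail : ∀ v → catFrom (b′ ∷ toList v) w (suc o) ≡ catFrom v w o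
  tail (_ ∷ _) = refl

module EgoDefeat (σ : EgoStrategy) where

  replyA replyB : ℕ → List Word → Word
  replyA zero    _  = false ∷ []
  replyA (suc _) hB = σ hB
  replyB zero    hA = true ∷ toList (σ hA)
  replyB (suc _) hA = σ hA

  histories : ℕ → List Word × List Word
  histories zero    = [] , []
  histories (suc n) = hA , proj₂ (histories n) ∷ʳ replyB n hA
    where hA = proj₁ (histories n) ∷ʳ replyA n (proj₂ (histories n))

  αA αB εA εB : ℕ → Word
  αA n = replyA n (proj₂ (histories n))
  αB n = replyB n (proj₁ (histories (suc n)))
  εA i = σ (prefix αA i)
  εB i = σ (prefix αB i)

  historyA : ∀ n → proj₁ (histories n) ≡ prefix αA n
  historyA = prefix-unique (proj₁ ∘ histories) αA refl (λ _ → refl)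

  historyB : ∀ n → proj₂ (histories n) ≡ prefix αB n
  historyB = prefix-unique (proj₂ ∘ histories) αB refl (λ _ → refl)

  common : ℕ → Word
  common = interleave (εB ∘ suc) (αB ∘ suc)

  outcomeA : egoOutcome σ αA ≗ catFrom (σ []) ((false ∷ []) ◂ εA 1 ◂ common)
  outcomeA = catFrom-cong (σ []) λ where
    zero          → refl
    (suc zero)    → refl
    (suc (suc k)) → interleave-cong (cong σ ∘ historyB ∘ suc) (sym ∘ cong σ ∘ historyA ∘ suc ∘ suc) k

  outcomeB : egoOutcome σ αB ≗ catFrom (σ []) ((true ∷ toList (εA 1)) ◂ common)
  outcomeB = catFrom-cong (σ []) λ where
    zero    → cong (λ h → true ∷ toList (σ h)) (historyA 1)
    (suc k) → refl

  L : ℕ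
  L = length (toList (σ []))

  outcomes-samePr : SamePr L (egoOutcome σ αA) (egoOutcome σ αB)
  outcomes-samePr k k≢L =
    trans (outcomeA k) (trans (catFrom-split (σ []) false true (εA 1) common k k≢L) (sym (outcomeB k)))

  outcomeA-at-L : egoOutcome σ αA (L + 0) ≡ false
  outcomeA-at-L = trans (outcomeA (L + 0)) (catFrom-offset (σ []) _ 0)

  outcomeB-at-L : egoOutcome σ αB (L + 0) ≡ true
  outcomeB-at-L = trans (outcomeB (L + 0)) (catFrom-offset (σ []) _ 0)

egoLoses : (T : Subset) → Thin T → ¬ (∃ λ σ → EgoWins T σ)
egoLoses T thin (σ , win) = contradiction false≡true λ ()
  where
  open EgoDefeat σ
  open ≡-Reasoning
  false≡true : false ≡ true
  false≡true = begin
    false                   ≡⟨ outcomeA-at-L ⟨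
    egoOutcome σ αA (L + 0) ≡⟨ thin L _ _ (win αA) (win αB) outcomes-samePr (L + 0) ⟩
    egoOutcome σ αB (L + 0) ≡⟨ outcomeB-at-L ⟩
    true                    ∎

-- Sequences defined by course-of-values recursion

module CourseOfValues (default : A) (step : ℕ → (ℕ → A) → A)
  (step-local : ∀ n {g g′} → AgreeBelow n g g′ → step n g ≡ step n g′) where

  private
    restrict : ∀ n → (∀ {m} → m < n → A) → ℕ → A
    restrict n rec m with m <? n
    ... | yes m<n = rec m<n
    ... | no  _   = default

    restrict-below : ∀ n {rec : ∀ {m} → m < n → A} {m} (m<n : m < n) → restrict n rec m ≡ rec m<n
    restrict-below n {rec} {m} m<n with m <? n
    ... | yes m<n′ = cong (λ p → rec p) (<-irrelevant m<n′ m<n)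
    ... | no  m≮n  = contradiction m<n m≮n

    stepBelow : ∀ n → (∀ {m} → m < n → A) → A
    stepBelow n rec = step n (restrict n rec)

    open FixPoint <-wellFounded (λ _ → A) stepBelow
      (λ n eq → step-local n (λ m<n → trans (restrict-below n m<n)
                                        (trans (eq m<n) (sym (restrict-below n m<n)))))

  -- Opaque, since unfolding the well-founded recursion during unification is ruinous.
  opaque
    fix : ℕ → A
    fix = All.wfRec <-wellFounded _ (λ _ → A) stepBelow

    fix-unfold : ∀ n → fix n ≡ step n fix
    fix-unfold n = trans unfold-wfRec (step-local n (restrict-below n))

-- Cantor pairing

triangle : ℕ → ℕ
triangle zero    = 0
triangle (suc d) = suc (triangle d + d)

pair : ℕ → ℕ → ℕ
pair j i = triangle (j + i) + i

unpair : ℕ → ℕ × ℕ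
unpair zero    = 0 , 0
unpair (suc n) = next (unpair n)
  where
  next : ℕ × ℕ → ℕ × ℕ
  next (zero  , i) = suc i , 0
  next (suc j , i) = j , suc i

unpair-triangle : ∀ d i → i ≤ d → unpair (triangle d + i) ≡ (d ∸ i , i)
unpair-triangle zero    zero    _ = refl
unpair-triangle (suc d) zero    _
  rewrite +-identityʳ (triangle d + d) | unpair-triangle d d ≤-refl | n∸n≡0 d = refl
unpair-triangle d       (suc i) i<d
  rewrite +-suc (triangle d) i | unpair-triangle d i (<⇒≤ i<d) | +-∸-assoc 1 i<d = refl

unpair-pair : ∀ j i → unpair (pair j i) ≡ (j , i)
unpair-pair j i rewrite unpair-triangle (j + i) i (m≤n+m i j) | m+n∸n≡m j i = refl

pair-unpair : ∀ n → uncurry pair (unpair n) ≡ n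
pair-unpair zero = refl
pair-unpair (suc n) with unpair n | pair-unpair n
... | zero  , i | refl rewrite +-identityʳ i | +-identityʳ (triangle i + i) = refl
... | suc j , i | refl rewrite +-suc j i | +-suc (triangle (suc (j + i))) i = refl

pair-< : ∀ j i → pair j i < pair j (suc i)
pair-< j i rewrite +-suc j i | +-suc (triangle (suc (j + i))) i =
  s≤s (+-monoˡ-≤ i (≤-trans (m≤m+n (triangle (j + i)) (j + i)) (n≤1+n _)))

pair-mono : ∀ j {k i} → k ≤ i → pair j k ≤ pair j i
pair-mono j = increasing⇒monotone (pair j) (pair-< j) _

i≤pair : ∀ j i → i ≤ pair j i
i≤pair j i = m≤n+m i (triangle (j + i))

-- Finitely supported masks

xor-involutiveʳ : ∀ x y → (x xor y) xor y ≡ x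
xor-involutiveʳ x y = trans (xor-assoc x y y) (trans (cong (x xor_) (xor-same y)) (xor-identityʳ x))

xor-cancelˡ : ∀ x y → x xor (x xor y) ≡ y
xor-cancelˡ x y = trans (sym (xor-assoc x x y)) (cong (_xor y) (xor-same x))

-- ℕᵇ is bijective base-2 notation, so its digit strings are all finite bit strings.
mask : ℕᵇ → Seq
mask 0ᵇ       _       = false
mask 2[1+ x ] zero    = true
mask 1+[2 x ] zero    = false
mask 2[1+ x ] (suc k) = mask x k
mask 1+[2 x ] (suc k) = mask x k

finiteSupport⇒mask : ∀ d N → (∀ k → N ≤ k → d k ≡ false) → ∃ λ x → mask x ≗ d
finiteSupport⇒mask d zero    d≡false = 0ᵇ , λ k → sym (d≡false k z≤n)
finiteSupport⇒mask d (suc N) d≡false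
  with finiteSupport⇒mask (d ∘ suc) N (λ k N≤k → d≡false (suc k) (s≤s N≤k)) | d 0 in d₀
... | x , mask≗ | true  = 2[1+ x ] , λ where
  zero    → sym d₀
  (suc k) → mask≗ k
... | x , mask≗ | false = 1+[2 x ] , λ where
  zero    → sym d₀
  (suc k) → mask≗ k

maskOf : ℕ → Seq
maskOf j = mask (fromℕ j)

finiteSupport⇒maskOf : ∀ d N → (∀ k → N ≤ k → d k ≡ false) → ∃ λ j → maskOf j ≗ d
finiteSupport⇒maskOf d N d≡false with finiteSupport⇒mask d N d≡false
... | x , mask≗ = toℕ x , λ k → trans (cong (λ y → mask y k) (fromℕ-toℕ x)) (mask≗ k)

xorWith : Seq → List Bool → List Bool
xorWith m []      = []
xorWith m (b ∷ l) = (b xor m 0) ∷ xorWith (m ∘ suc) l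

xorWord : Seq → Word → Word
xorWord m (b ∷ l) = (b xor m 0) ∷ xorWith (m ∘ suc) l

toList-xorWord : ∀ m w → toList (xorWord m w) ≡ xorWith m (toList w)
toList-xorWord m (b ∷ l) = refl

length-xorWith : ∀ m l → length (xorWith m l) ≡ length l
length-xorWith m []      = refl
length-xorWith m (b ∷ l) = cong suc (length-xorWith (m ∘ suc) l)

xorWith-involutive : ∀ m l → xorWith m (xorWith m l) ≡ l
xorWith-involutive m []      = refl
xorWith-involutive m (b ∷ l) = cong₂ _∷_ (xor-involutiveʳ b (m 0)) (xorWith-involutive (m ∘ suc) l)

xorWith-++ : ∀ m l r → xorWith m (l ++ r) ≡ xorWith m l ++ xorWith (λ k → m (length l + k)) r
xorWith-++ m []      r = refl
xorWith-++ m (b ∷ l) r = cong ((b xor m 0) ∷_) (xorWith-++ (m ∘ suc) l r)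

⊑-xorWith : ∀ m l {x} → l ⊑ x → xorWith m l ⊑ (λ k → x k xor m k)
⊑-xorWith m []      _           = tt
⊑-xorWith m (b ∷ l) (b≡x₀ , l⊑) = cong (_xor m 0) b≡x₀ , ⊑-xorWith (m ∘ suc) l l⊑

start : ℕ → ℕ → ℕ
start j zero    = 0
start j (suc i) = suc (pair j i)

start≤pair : ∀ j i → start j i ≤ pair j i
start≤pair j zero    = z≤n
start≤pair j (suc i) = pair-< j i

i≤start : ∀ j i → i ≤ start j i
i≤start j zero    = z≤n
i≤start j (suc i) = s≤s (i≤pair j i)

-- Against τ, Ego plays game j for every j, each against the mask of j.
-- Block pair j i of the spine holds, up to that mask, Alter's i-th answer in
-- game j, and Ego's moves in game j copy the masked spine between those
-- blocks, so game j produces the masked spine. Each block starts with a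
-- separator bit, which keeps Ego's moves nonempty.
module AlterDefeat (τ : AlterStrategy) where

  block : (ℕ → Word) → ℕ → Word
  block g m = false ∷ toList (g m)

  spine : (ℕ → Word) → Seq
  spine g = concatω (block g)

  pos : (ℕ → Word) → ℕ → ℕ
  pos g n = length (flat (block g) n)

  pos-< : ∀ g n → pos g n < pos g (suc n)
  pos-< g n = subst (pos g n <_)
    (sym (trans (cong length (flat-snoc (block g) n)) (length-++ (flat (block g) n))))
    (m<m+n (pos g n) z<s)

  n≤pos : ∀ g n → n ≤ pos g n
  n≤pos g = increasing⇒≥id (pos g) (pos-< g)

  variant : (ℕ → Word) → ℕ → Seq
  variant g j k = spine g k xor maskOf j k

  variantPrefix : (ℕ → Word) → ℕ → ℕ → List Bool
  variantPrefix g j n = xorWith (maskOf j) (flat (block g) n)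

  variantPrefix-⊑ : ∀ g j n → variantPrefix g j n ⊑ variant g j
  variantPrefix-⊑ g j n = ⊑-xorWith (maskOf j) _ (⊑-concatω (block g) n)

  length-variantPrefix : ∀ g j n → length (variantPrefix g j n) ≡ pos g n
  length-variantPrefix g j n = length-xorWith (maskOf j) (flat (block g) n)

  egoMove : (ℕ → Word) → ℕ → ℕ → Word
  egoMove g j i = drop (pos g (start j i)) (variantPrefix g j (pair j i)) ∷ʳ⁺ maskOf j (pos g (pair j i))

  answerMask : (ℕ → Word) → ℕ → ℕ → Seq
  answerMask g j n k = maskOf j (pos g n + suc k)

  reply : (ℕ → Word) → ℕ → ℕ → Word
  reply g j i = xorWord (answerMask g j (pair j i)) (τ (prefix (egoMove g j) (suc i)))

  step : ℕ → (ℕ → Word) → Word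
  step n g = uncurry (reply g) (unpair n)

  flat-block-local : ∀ {g g′} n → AgreeBelow n g g′ → flat (block g) n ≡ flat (block g′) n
  flat-block-local n agree = flat-local n (cong (λ u → false ∷ toList u) ∘ agree)

  egoMove-local : ∀ j i {g g′} → AgreeBelow (pair j i) g g′ → egoMove g j i ≡ egoMove g′ j i
  egoMove-local j i agree =
    cong₂ (λ s p → drop (length s) (xorWith (maskOf j) p) ∷ʳ⁺ maskOf j (length p))
      (flat-block-local (start j i) (agree ∘ (λ m< → <-≤-trans m< (start≤pair j i))))
      (flat-block-local (pair j i) agree)

  reply-local : ∀ j i {g g′} → AgreeBelow (pair j i) g g′ → reply g j i ≡ reply g′ j i
  reply-local j i agree =
    cong₂ (λ p moves → xorWord (λ k → maskOf j (p + suc k)) (τ moves))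
      (cong length (flat-block-local (pair j i) agree))
      (prefix-local (suc i) λ k<1+i →
        egoMove-local j _ (agree ∘ (λ m< → <-≤-trans m< (pair-mono j (≤-pred k<1+i)))))

  step-local : ∀ n {g g′} → AgreeBelow n g g′ → step n g ≡ step n g′
  step-local n agree with unpair n | pair-unpair n
  ... | j , i | refl = reply-local j i agree

  open CourseOfValues (false ∷ []) step step-local

  answers : ℕ → Word
  answers = fix

  answers-pair : ∀ j i → answers (pair j i) ≡ reply answers j i
  answers-pair j i = trans (fix-unfold (pair j i)) (cong (uncurry (reply answers)) (unpair-pair j i))

  variantPrefix-suc : ∀ g j n → variantPrefix g j (suc n)
                      ≡ variantPrefix g j n ++ maskOf j (pos g n) ∷ xorWith (answerMask g j n) (toList (g n))
  variantPrefix-suc g j n = begin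
    xorWith (maskOf j) (flat (block g) (suc n))
      ≡⟨ cong (xorWith (maskOf j)) (flat-snoc (block g) n) ⟩
    xorWith (maskOf j) (flat (block g) n ++ toList (block g n))
      ≡⟨ xorWith-++ (maskOf j) (flat (block g) n) _ ⟩
    variantPrefix g j n ++ maskOf j (pos g n + 0) ∷ rest
      ≡⟨ cong (λ p → variantPrefix g j n ++ maskOf j p ∷ rest) (+-identityʳ (pos g n)) ⟩
    variantPrefix g j n ++ maskOf j (pos g n) ∷ rest
      ∎
    where
    open ≡-Reasoning
    rest = xorWith (answerMask g j n) (toList (g n))

  variantPrefix-extends : ∀ g j {a n} → a ≤ n →
                          variantPrefix g j a ++ drop (pos g a) (variantPrefix g j n) ≡ variantPrefix g j n
  variantPrefix-extends g j {a} {n} a≤n with flat-extends (block g) a≤n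
  ... | r , extends = begin
    V a ++ drop (pos g a) (V n)                      ≡⟨ cong (λ k → V a ++ drop k (V n)) (length-variantPrefix g j a) ⟨
    V a ++ drop (length (V a)) (V n)                 ≡⟨ cong (λ l → V a ++ drop (length (V a)) l) V-extends ⟩
    V a ++ drop (length (V a)) (V a ++ xorWith _ r)  ≡⟨ cong (V a ++_) (drop-length-++ (V a) _) ⟩
    V a ++ xorWith _ r                               ≡⟨ V-extends ⟨
    V n                                              ∎
    where
    open ≡-Reasoning
    V = variantPrefix g j
    V-extends : V n ≡ V a ++ xorWith _ r
    V-extends = trans (cong (xorWith (maskOf j)) extends) (xorWith-++ (maskOf j) (flat (block g) a) r)

  module Game (j : ℕ) where

    ε α W : ℕ → Word
    ε = egoMove answers j
    α i = τ (prefix ε (suc i))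
    W = interleave ε α

    answer-decoded : ∀ i → toList (α i) ≡ xorWith (answerMask answers j (pair j i)) (toList (answers (pair j i)))
    answer-decoded i = sym (begin
      xorWith m (toList (answers (pair j i)))      ≡⟨ cong (xorWith m ∘ toList) (answers-pair j i) ⟩
      xorWith m (toList (xorWord m (α i)))         ≡⟨ cong (xorWith m) (toList-xorWord m (α i)) ⟩
      xorWith m (xorWith m (toList (α i)))         ≡⟨ xorWith-involutive m (toList (α i)) ⟩
      toList (α i)                                 ∎)
      where
      open ≡-Reasoning
      m = answerMask answers j (pair j i)

    flat-play : ∀ i → flat W (i + i) ≡ variantPrefix answers j (start j i)
    flat-play zero    = refl
    flat-play (suc i) = begin
      flat W (suc i + suc i)
        ≡⟨ flat-interleave ε α i ⟩
      flat W (i + i) ++ toList (ε i) ++ toList (α i)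
        ≡⟨ cong₂ (λ l r → l ++ r ++ toList (α i)) (flat-play i) (toList-∷ʳ _ _) ⟩
      V (start j i) ++ (drop s (V n) ++ sep ∷ []) ++ toList (α i)
        ≡⟨ cong (V (start j i) ++_) (++-assoc (drop s (V n)) _ _) ⟩
      V (start j i) ++ drop s (V n) ++ sep ∷ toList (α i)
        ≡⟨ ++-assoc (V (start j i)) _ _ ⟨
      (V (start j i) ++ drop s (V n)) ++ sep ∷ toList (α i)
        ≡⟨ cong₂ (λ l r → l ++ sep ∷ r) (variantPrefix-extends answers j (start≤pair j i)) (answer-decoded i) ⟩
      V n ++ sep ∷ xorWith (answerMask answers j n) (toList (answers n))
        ≡⟨ variantPrefix-suc answers j n ⟨
      V (suc n) ∎
      where
      open ≡-Reasoning
      V = variantPrefix answers j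
      n = pair j i
      s = pos answers (start j i)
      sep = maskOf j (pos answers n)

    outcome : alterOutcome τ ε ≗ variant answers j
    outcome k = ⊑-agree P {alterOutcome τ ε} {variant answers j} (⊑-concatω W (suc k + suc k)) P⊑variant k<∣P∣
      where
      P = flat W (suc k + suc k)
      a = start j (suc k)
      P⊑variant : P ⊑ variant answers j
      P⊑variant = subst (_⊑ variant answers j) (sym (flat-play (suc k))) (variantPrefix-⊑ answers j a)
      k<∣P∣ : k < length P
      k<∣P∣ = subst (k <_) (sym (trans (cong length (flat-play (suc k))) (length-variantPrefix answers j a)))
                (≤-trans (i≤start j (suc k)) (n≤pos answers a))

  ∼spine⇒outcome : ∀ t → t ∼ spine answers → ∃ λ ε → t ≗ alterOutcome τ ε
  ∼spine⇒outcome t (N , t≈spine) =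
    let j , mask≗ = finiteSupport⇒maskOf d N d-vanishes
    in  Game.ε j , λ k → begin
          t k                          ≡⟨ xor-cancelˡ (spine answers k) (t k) ⟨
          spine answers k xor d k      ≡⟨ cong (spine answers k xor_) (mask≗ k) ⟨
          variant answers j k          ≡⟨ Game.outcome j k ⟨
          alterOutcome τ (Game.ε j) k  ∎
    where
    open ≡-Reasoning
    d : Seq
    d k = spine answers k xor t k
    d-vanishes : ∀ k → N ≤ k → d k ≡ false
    d-vanishes k N≤k = trans (cong (spine answers k xor_) (t≈spine k N≤k)) (xor-same (spine answers k))

alterLoses : (T : Subset) → Extensional T → MeetsAllClasses T → ¬ (∃ λ τ → AlterWins T τ)
alterLoses T ext meets (τ , win) =
  let t , t∈T , t∼spine = meets (spine answers)
      ε , t≗outcome     = ∼spine⇒outcome t t∼spine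
  in  win ε (ext t _ t≗outcome t∈T)
  where open AlterDefeat τ

mainTheorem6 : (T : Subset) → Extensional T → Thin T → MeetsAllClasses T → Undetermined T
mainTheorem6 T ext thin meets = egoLoses T thin , alterLoses T ext meets
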